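{- The program NQUEENS is complete with respect to the specification $S^0 = S_{pq}\cup S^0_{pqs}\cup\{pqs(0,cs,us,ds)\mid cs,us,ds\in\mathcal{HU}\}$, i.e.\ $S^0\subseteq \mathcal{M}_{\text{NQUEENS}}$, where $\mathcal{M}_P$ denotes the least Herbrand model of a program $P$.
   Context: NQUEENS is the definite logic program (Prolog syntax, natural numbers represented as $0, s(0), s(s(0)),\ldots$; each \_ is a distinct variable): pqs(0,_,_,_). pqs(s(I),Cs,Us,[_|Ds]) :- pqs(I,Cs,[_|Us],Ds), pq(s(I),Cs,Us,Ds). pq(I,[I|_],[I|_],[I|_]). pq(I,[_|Cs],[_|Us],[_|Ds]) :- pq(I,Cs,Us,Ds). A specification is a Herbrand interpretation $S$; a program $P$ is complete w.r.t.\ $S$ when $S\subseteq\mathcal{M}_P$. $\mathcal{HU}$ is the Herbrand universe, $\mathcal{HB}$ the Herbrand base. A term $e$ is the $k$-th member ($k>0$) of a term $t$ if $t=[e_1,\ldots,e_{k-1},e|e']$ for some terms $e_1,\ldots,e_{k-1},e'$. $S_{pq} = \{\, pq(i,[c_1,\ldots,c_k,i|c],[u_1,\ldots,u_k,i|u],[d_1,\ldots,d_k,i|d]) \in \mathcal{HB} \mid k\ge 0\,\}$. If a number $j$ is the $k$-th member of a list $cs$, its up-diagonal number w.r.t.\ $i$ in $cs$ is $k+j-i$ and its down-diagonal number w.r.t.\ $i$ is $k+i-j$. A triple $(cs,us,ds)$ is correct up to $m$ w.r.t.\ $i$ when $0\le m\le i$, $cs$ is a list of distinct members, each $j\in\{1,\ldots,m\}$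 is a member of $cs$, the up-diagonal numbers of $1,\ldots,m$ in $cs$ are pairwise distinct and likewise the down-diagonal numbers, and for each $j\in\{1,\ldots,m\}$: if the up (resp.\ down) diagonal number of $j$ w.r.t.\ $i$ in $cs$ is $l>0$ then the $l$-th member of $us$ (resp.\ $ds$) is $j$. $S^0_{pqs} = \{ pqs(i,cs,us,[t|ds])\in\mathcal{HB} \mid i>0,\ (cs,us,ds) \text{ is correct up to } i \text{ w.r.t.\ } i\}$. -}

module Defs where

open import Data.Nat using (ℕ; zero; suc; _≤_; _<_)
open import Data.Integer using (ℤ; +_; _-_; _+_) renaming (_<_ to _<ℤ_)
open import Data.List using (List; []; _∷_; length)
open import Data.List.Relation.Unary.Unique.Propositional using (Unique)
open import Data.Vec using (Vec)
open import Data.Product using (Σ; ∃; ∃-syntax; _×_; _,_)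
open import Data.Sum using (_⊎_)
open import Relation.Binary.PropositionalEquality using (_≡_; _≢_)

-- An alphabet of function symbols.  It always contains the symbols of the
-- program: the constant 0, the unary s, the list constructors [] and [_|_];
-- any further function symbols (with arities) are given by the signature.
record Sig : Set₁ where
  field
    Fun   : Set
    arity : Fun → ℕ

module NQ (σ : Sig) where
  open Sig σ

  -- Herbrand universe HU (ground terms)
  data Term : Set where
    z    : Term
    s    : Term → Term
    nil  : Term
    cons : Term → Term → Term
    app  : (f : Fun) → Vec Term (arity f) → Term

  -- Herbrand base HB (ground atoms)
  data Atom : Set where
    pqs : Term → Term → Term → Term → Atom
    pq  : Term → Term → Term → Term → Atom

  num : ℕ → Term
  num zero    = z
  num (suc n) = s (num n)

  _++ᵗ_ : List Term → Term → Term
  []       ++ᵗ t = t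
  (e ∷ es) ++ᵗ t = cons e (es ++ᵗ t)

  ⌜_⌝ : List Term → Term
  ⌜ es ⌝ = es ++ᵗ nil

  KthMember : ℕ → Term → Term → Set
  KthMember k e t =
    0 < k × Σ (List Term) λ es → length es ≡ k Data.Nat.∸ 1 × ∃[ e′ ] t ≡ es ++ᵗ cons e e′

  -- Least Herbrand model of NQUEENS: the least set of ground atoms closed
  -- under all ground instances of the clauses.
  data M : Atom → Set where
    pqs-0 : ∀ a b c → M (pqs z a b c)
    pqs-s : ∀ i cs us d ds u →
            M (pqs i cs (cons u us) ds) → M (pq (s i) cs us ds) →
            M (pqs (s i) cs us (cons d ds))
    pq-1  : ∀ i c u d → M (pq i (cons i c) (cons i u) (cons i d))
    pq-2  : ∀ i c cs u us d ds → M (pq i cs us ds) →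
            M (pq i (cons c cs) (cons u us) (cons d ds))

  upDiag : ℕ → ℕ → ℕ → ℤ
  upDiag k j i = (+ k + + j) - + i

  downDiag : ℕ → ℕ → ℕ → ℤ
  downDiag k j i = (+ k + + i) - + j

  record CorrectUpTo (cs us ds : Term) (m i : ℕ) : Set where
    field
      m≤i       : m ≤ i
      distinct  : ∃[ l ] (cs ≡ ⌜ l ⌝ × Unique l)
      members   : ∀ j → 1 ≤ j → j ≤ m → ∃[ k ] KthMember k (num j) cs
      upDistinct : ∀ j₁ j₂ k₁ k₂ → 1 ≤ j₁ → j₁ ≤ m → 1 ≤ j₂ → j₂ ≤ m → j₁ ≢ j₂ →
                   KthMember k₁ (num j₁) cs → KthMember k₂ (num j₂) cs →
                   upDiag k₁ j₁ i ≢ upDiag k₂ j₂ i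
      downDistinct : ∀ j₁ j₂ k₁ k₂ → 1 ≤ j₁ → j₁ ≤ m → 1 ≤ j₂ → j₂ ≤ m → j₁ ≢ j₂ →
                   KthMember k₁ (num j₁) cs → KthMember k₂ (num j₂) cs →
                   downDiag k₁ j₁ i ≢ downDiag k₂ j₂ i
      upPlaced  : ∀ j k l → 1 ≤ j → j ≤ m → KthMember k (num j) cs →
                  upDiag k j i ≡ + l → 0 < l → KthMember l (num j) us
      downPlaced : ∀ j k l → 1 ≤ j → j ≤ m → KthMember k (num j) cs →
                  downDiag k j i ≡ + l → 0 < l → KthMember l (num j) ds

  Spq : Atom → Set
  Spq (pqs _ _ _ _) = Data.Empty.⊥ where import Data.Empty
  Spq (pq i cs us ds) =
    Σ (List Term) λ cs′ → Σ (List Term) λ us′ → Σ (List Term) λ ds′ →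
      length us′ ≡ length cs′ × length ds′ ≡ length cs′ ×
      ∃[ c ] ∃[ u ] ∃[ d ]
        (cs ≡ cs′ ++ᵗ cons i c × us ≡ us′ ++ᵗ cons i u × ds ≡ ds′ ++ᵗ cons i d)

  S0pqs : Atom → Set
  S0pqs (pq _ _ _ _) = Data.Empty.⊥ where import Data.Empty
  S0pqs (pqs n cs us tds) =
    ∃[ i ] ∃[ t ] ∃[ ds ]
      (n ≡ num i × tds ≡ cons t ds × 0 < i × CorrectUpTo cs us ds i i)

  Spqs0 : Atom → Set
  Spqs0 (pq _ _ _ _) = Data.Empty.⊥ where import Data.Empty
  Spqs0 (pqs n _ _ _) = n ≡ z

  S0 : Atom → Set
  S0 a = Spq a ⊎ S0pqs a ⊎ Spqs0 a

-- An atom of S_pq has i at one common position of its three lists, which the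
-- pq clauses reach by peeling off equally long prefixes.  For S⁰_pqs we induct
-- on i: pqs(s(n), cs, us, [t|ds]) follows from pq(s(n), cs, us, ds), since
-- the queen s(n) sits in cs, us and ds at one and the same position, and from
-- pqs(n, cs, [u|us], ds).  Shifting the diagonal lists by one position keeps
-- the placement invariant for the queens 1..n, provided u is the queen whose
-- up-diagonal becomes the new first one; that queen is unique because up
-- diagonals are distinct, so a search along cs finds it.
module Submission where

open import Defs
open import Data.Nat using (ℕ; zero; suc; _+_; _∸_; _≤_; z≤n; s≤s)
open import Data.Nat.Properties using (≤-refl; m≤n⇒m≤1+n; m≤n+m; +-comm; +-suc; m+n∸m≡n; m≤m+n; suc-injective; _≟_)
open import Data.Integer using (+_; _-_)
open import Data.Integer.Properties using (m-n≡m⊖n; ⊖-≥)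
open import Data.List using ([]; _∷_; length)
open import Data.Product using (∃; ∃₂; _,_)
open import Data.Sum using (inj₁; inj₂)
open import Relation.Nullary using (Dec; yes; no; contradiction)
open import Relation.Nullary.Decidable using (decidable-stable)
open import Relation.Binary.PropositionalEquality using (_≡_; refl; sym; trans; cong; subst)

m≡n+o⇒+m-+n≡+o : ∀ {m n o} → m ≡ n + o → + m - + n ≡ + o
m≡n+o⇒+m-+n≡+o {n = n} {o} refl =
  trans (m-n≡m⊖n (n + o) n) (trans (⊖-≥ (m≤m+n n o)) (cong +_ (m+n∸m≡n n o)))

module _ {σ : Sig} where
  open NQ σ

  -- Positions count from 0, whereas KthMember counts from 1.
  data At : ℕ → Term → Term → Set where
    here  : ∀ {e t} → At 0 e (cons e t)
    there : ∀ {p e x t} → At p e t → At (suc p) e (cons x t)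

  At-++ᵗ : ∀ es {e t} → At (length es) e (es ++ᵗ cons e t)
  At-++ᵗ []       = here
  At-++ᵗ (_ ∷ es) = there (At-++ᵗ es)

  At⇒cons : ∀ {p e t} → At p e t → ∃₂ λ x t′ → t ≡ cons x t′
  At⇒cons (here {t = t})    = _ , t , refl
  At⇒cons (there {t = t} _) = _ , t , refl

  kthMember⇒At : ∀ {k e t} → KthMember k e t → At (k ∸ 1) e t
  kthMember⇒At {suc k} (_ , es , refl , _ , refl) = At-++ᵗ es

  At⇒kthMember : ∀ {p e t} → At p e t → KthMember (suc p) e t
  At⇒kthMember (here {t = t}) = s≤s z≤n , [] , refl , t , refl
  At⇒kthMember (there {x = x} a) with At⇒kthMember a
  ... | _ , es , |es|≡p , e′ , refl = s≤s z≤n , x ∷ es , cong suc |es|≡p , e′ , refl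

  pq-At : ∀ {p i cs us ds} → At p i cs → At p i us → At p i ds → M (pq i cs us ds)
  pq-At here      here      here      = pq-1 _ _ _ _
  pq-At (there a) (there b) (there c) = pq-2 _ _ _ _ _ _ _ (pq-At a b c)

  Spq⇒M : ∀ a → Spq a → M a
  Spq⇒M (pq i _ _ _) (cs , us , ds , |us|≡|cs| , |ds|≡|cs| , _ , _ , _ , refl , refl , refl) =
    pq-At (At-++ᵗ cs)
      (subst (λ p → At p i _) |us|≡|cs| (At-++ᵗ us))
      (subst (λ p → At p i _) |ds|≡|cs| (At-++ᵗ ds))
  Spq⇒M (pqs _ _ _ _) ()

  -- CorrectUpTo cs us ds n n restated over ℕ: the queen j at position p has
  -- up- and down-diagonal numbers (p + 1) + j − n and (p + 1) + n − j, and
  -- only the positive ones, d + 1, constrain us and ds.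
  record Board (n : ℕ) (cs us ds : Term) : Set where
    field
      queen : ∀ j → 1 ≤ j → j ≤ n → ∃ λ p → At p (num j) cs
      up    : ∀ {p j d} → At p (num j) cs → 1 ≤ j → j ≤ n → p + j ≡ n + d → At d (num j) us
      down  : ∀ {p j d} → At p (num j) cs → 1 ≤ j → j ≤ n → p + n ≡ j + d → At d (num j) ds
      up-injective : ∀ {p₁ j₁ p₂ j₂} → At p₁ (num j₁) cs → At p₂ (num j₂) cs →
                     1 ≤ j₁ → j₁ ≤ n → 1 ≤ j₂ → j₂ ≤ n → p₁ + j₁ ≡ p₂ + j₂ → j₁ ≡ j₂
  open Board

  correct⇒Board : ∀ {cs us ds n} → CorrectUpTo cs us ds n n → Board n cs us ds
  correct⇒Board c .queen j 1≤j j≤n with k , kth ← CorrectUpTo.members c j 1≤j j≤n =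
    k ∸ 1 , kthMember⇒At kth
  correct⇒Board {n = n} c .up {p} {j} {d} a 1≤j j≤n e =
    kthMember⇒At (CorrectUpTo.upPlaced c j (suc p) (suc d) 1≤j j≤n (At⇒kthMember a)
      (m≡n+o⇒+m-+n≡+o (trans (cong suc e) (sym (+-suc n d)))) (s≤s z≤n))
  correct⇒Board {n = n} c .down {p} {j} {d} a 1≤j j≤n e =
    kthMember⇒At (CorrectUpTo.downPlaced c j (suc p) (suc d) 1≤j j≤n (At⇒kthMember a)
      (m≡n+o⇒+m-+n≡+o (trans (cong suc e) (sym (+-suc j d)))) (s≤s z≤n))
  correct⇒Board {n = n} c .up-injective {p₁} {j₁} {p₂} {j₂} a₁ a₂ 1≤j₁ j₁≤n 1≤j₂ j₂≤n e =
    decidable-stable (j₁ ≟ j₂) λ j₁≢j₂ →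
      CorrectUpTo.upDistinct c j₁ j₂ (suc p₁) (suc p₂) 1≤j₁ j₁≤n 1≤j₂ j₂≤n j₁≢j₂
        (At⇒kthMember a₁) (At⇒kthMember a₂) (cong (λ m → + suc m - + n) e)

  _≟num_ : (e : Term) (k : ℕ) → Dec (e ≡ num k)
  z        ≟num zero  = yes refl
  s e      ≟num suc k with e ≟num k
  ... | yes refl = yes refl
  ... | no e≢k   = no λ { refl → e≢k refl }
  z        ≟num suc _ = no λ ()
  s _      ≟num zero  = no λ ()
  nil      ≟num zero  = no λ ()
  nil      ≟num suc _ = no λ ()
  cons _ _ ≟num zero  = no λ ()
  cons _ _ ≟num suc _ = no λ ()
  app _ _  ≟num zero  = no λ ()
  app _ _  ≟num suc _ = no λ ()

  -- The member num j of cs at a position p with p + j ≡ n, if there is one.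
  firstUpQueen : ℕ → Term → Term
  firstUpQueen (suc m) (cons e t) with e ≟num suc m
  ... | yes _ = e
  ... | no _  = firstUpQueen m t
  firstUpQueen _ _ = z

  firstUpQueen-unique : ∀ {p j n cs} → At p (num (suc j)) cs → p + suc j ≡ n →
    (∀ {p′ j′} → At p′ (num (suc j′)) cs → p′ + suc j′ ≡ n → j′ ≡ j) →
    firstUpQueen n cs ≡ num (suc j)
  firstUpQueen-unique {j = j} here refl _ with num (suc j) ≟num suc j
  ... | yes _     = refl
  ... | no ≢self  = contradiction refl ≢self
  firstUpQueen-unique {suc p} {j} (there {x = x} a) refl unique with x ≟num suc (p + suc j)
  ... | yes refl = cong (λ k → num (suc k)) (unique here refl)
  ... | no _     = firstUpQueen-unique a refl (λ a′ e′ → unique (there a′) (cong suc e′))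

  shift : ∀ {n cs us t ds} → Board (suc n) cs us (cons t ds) →
          Board n cs (cons (firstUpQueen n cs) us) ds
  shift b .queen j 1≤j j≤n = queen b j 1≤j (m≤n⇒m≤1+n j≤n)
  shift {n} b .down {p} {j} {d} a 1≤j j≤n e with there a′ ←
    down b a 1≤j (m≤n⇒m≤1+n j≤n) (trans (+-suc p n) (trans (cong suc e) (sym (+-suc j d)))) = a′
  shift {n} b .up {d = suc d} a 1≤j j≤n e =
    there (up b a 1≤j (m≤n⇒m≤1+n j≤n) (trans e (+-suc n d)))
  shift {n} {cs} {us} b .up {p} {suc j} {zero} a 1≤j j≤n e =
    subst (λ u → At 0 (num (suc j)) (cons u us)) (sym (firstUpQueen-unique a p+j≡n unique)) here
    where
      p+j≡n : p + suc j ≡ n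
      p+j≡n = trans e (+-comm n 0)
      unique : ∀ {p′ j′} → At p′ (num (suc j′)) cs → p′ + suc j′ ≡ n → j′ ≡ j
      unique {p′} {j′} a′ e′ = suc-injective
        (up-injective b a′ a (s≤s z≤n) (m≤n⇒m≤1+n (subst (suc j′ ≤_) e′ (m≤n+m (suc j′) p′)))
          1≤j (m≤n⇒m≤1+n j≤n) (trans e′ (sym p+j≡n)))
  shift b .up-injective a₁ a₂ 1≤j₁ j₁≤n 1≤j₂ j₂≤n =
    up-injective b a₁ a₂ 1≤j₁ (m≤n⇒m≤1+n j₁≤n) 1≤j₂ (m≤n⇒m≤1+n j₂≤n)

  Board⇒pqs : ∀ n {cs us ds t} → Board n cs us ds → M (pqs (num n) cs us (cons t ds))
  Board⇒pqs zero _ = pqs-0 _ _ _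
  Board⇒pqs (suc n) {cs} {us} {t = t} b
    with p , a ← queen b (suc n) (s≤s z≤n) ≤-refl
    with a-ds ← down b a (s≤s z≤n) ≤-refl (+-comm p (suc n))
    with _ , _ , refl ← At⇒cons a-ds =
    pqs-s (num n) cs us t _ (firstUpQueen n cs) (Board⇒pqs n (shift b))
      (pq-At a (up b a (s≤s z≤n) ≤-refl (+-comm p (suc n))) a-ds)

  S0pqs⇒M : ∀ a → S0pqs a → M a
  S0pqs⇒M (pqs _ _ _ _) (n , _ , _ , refl , refl , _ , correct) = Board⇒pqs n (correct⇒Board correct)
  S0pqs⇒M (pq _ _ _ _) ()

open NQ

mainTheorem2 : (σ : Sig) (a : Atom σ) → S0 σ a → M σ a
mainTheorem2 σ a (inj₁ a∈Spq) = Spq⇒M a a∈Spq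
mainTheorem2 σ a (inj₂ (inj₁ a∈S0pqs)) = S0pqs⇒M a a∈S0pqs
mainTheorem2 σ (pqs _ _ _ _) (inj₂ (inj₂ refl)) = pqs-0 _ _ _
mainTheorem2 σ (pq _ _ _ _) (inj₂ (inj₂ ()))
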